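{- Let $\mathcal{C}\subseteq\mathbb{F}_q^{k\times m}$ be a linear code and let $U\subseteq\mathbb{F}_q^k$ be an $\mathbb{F}_q$-linear subspace of dimension $u$. Assume $|\mathcal{C}(U)| = |\mathcal{C}|/q^{m(k-u)}$. Then for all $X\in\mathbb{F}_q^{k\times m}$ we have $|(\mathcal{C}+X)(U)| = |\mathcal{C}|/q^{m(k-u)}$.
   Context: $q$ prime power, $k\le m$ positive integers. A linear code is an $\mathbb{F}_q$-subspace of $\mathbb{F}_q^{k\times m}$. For a set $\mathcal{S}\subseteq\mathbb{F}_q^{k\times m}$ and a subspace $U\subseteq\mathbb{F}_q^k$, $\mathcal{S}(U)$ denotes the set of matrices in $\mathcal{S}$ whose column space is contained in $U$. The translate is $\mathcal{C}+X=\{M+X : M\in\mathcal{C}\}$. -}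

module Defs where

open import Level using (0ℓ)
open import Data.Nat as ℕ using (ℕ; NonZero; _^_; _∸_)
import Data.Nat.Properties as ℕP
open import Data.Nat.DivMod using (_/_)
open import Data.Fin using (Fin)
open import Data.Vec using (Vec; []; _∷_; map; zipWith; replicate; foldr; lookup)
open import Data.List using (List; length)
open import Data.List.Membership.Propositional using (_∈_)
open import Data.List.Relation.Unary.Unique.Propositional using (Unique)
open import Data.Product using (Σ; ∃; _×_; _,_)
open import Data.Empty using (⊥-elim)
open import Relation.Nullary using (¬_)
open import Relation.Binary.PropositionalEquality using (_≡_; refl)
open import Function.Bundles using (_↔_; Inverse)
open import Algebra.Structures using (IsCommutativeRing)

-- A finite field F_q: a commutative ring (w.r.t. propositional equality)
-- with 0 ≠ 1, in which every nonzero element is invertible, together with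
-- a bijection Fin q ↔ Carrier (so q = |F|, necessarily a prime power).
record FiniteField : Set₁ where
  field
    Carrier : Set
    _+_ _*_ : Carrier → Carrier → Carrier
    -_      : Carrier → Carrier
    0# 1#   : Carrier
    isCommutativeRing : IsCommutativeRing _≡_ _+_ _*_ -_ 0# 1#
    0≢1     : ¬ (0# ≡ 1#)
    inverse : ∀ x → ¬ (x ≡ 0#) → Σ Carrier (λ y → x * y ≡ 1#)
    q       : ℕ
    enum    : Fin q ↔ Carrier

module _ (F : FiniteField) where
  open FiniteField F

  Vecᶠ : ℕ → Set
  Vecᶠ n = Vec Carrier n

  Mat : ℕ → ℕ → Set
  Mat k m = Vec (Vec Carrier m) k

  zeroV : ∀ {n} → Vecᶠ n
  zeroV = replicate _ 0#

  _+ᵥ_ : ∀ {n} → Vecᶠ n → Vecᶠ n → Vecᶠ n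
  _+ᵥ_ = zipWith _+_

  _·ᵥ_ : ∀ {n} → Carrier → Vecᶠ n → Vecᶠ n
  a ·ᵥ v = map (a *_) v

  zeroM : ∀ {k m} → Mat k m
  zeroM = replicate _ zeroV

  _+ₘ_ : ∀ {k m} → Mat k m → Mat k m → Mat k m
  _+ₘ_ = zipWith _+ᵥ_

  _·ₘ_ : ∀ {k m} → Carrier → Mat k m → Mat k m
  a ·ₘ M = map (a ·ᵥ_) M

  _⊛_ : ∀ {k m} → Mat k m → Vecᶠ m → Vecᶠ k
  M ⊛ c = map (λ row → foldr _ _+_ 0# (zipWith _*_ row c)) M

  ColSpace : ∀ {k m} → Mat k m → Vecᶠ k → Set
  ColSpace {m = m} M v = Σ (Vecᶠ m) (λ c → v ≡ M ⊛ c)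

  lincomb : ∀ {k u} → Vecᶠ u → Vec (Vecᶠ k) u → Vecᶠ k
  lincomb [] [] = zeroV
  lincomb (c ∷ cs) (b ∷ bs) = (c ·ᵥ b) +ᵥ lincomb cs bs

  record IsSubspace {k : ℕ} (U : Vecᶠ k → Set) : Set where
    field
      zero∈ : U zeroV
      +∈    : ∀ {v w} → U v → U w → U (v +ᵥ w)
      ·∈    : ∀ a {v} → U v → U (a ·ᵥ v)

  HasDim : ∀ {k} → (Vecᶠ k → Set) → ℕ → Set
  HasDim {k} U u = Σ (Vec (Vecᶠ k) u) λ b →
      (∀ c → lincomb c b ≡ zeroV → c ≡ replicate u 0#)
    × (∀ v → (U v → Σ (Vecᶠ u) (λ c → v ≡ lincomb c b))
            × (Σ (Vecᶠ u) (λ c → v ≡ lincomb c b) → U v))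

  record IsLinearCode {k m : ℕ} (C : Mat k m → Set) : Set where
    field
      zero∈ : C zeroM
      +∈    : ∀ {M N} → C M → C N → C (M +ₘ N)
      ·∈    : ∀ a {M} → C M → C (a ·ₘ M)

  -- S(U): matrices of S whose column space is contained in U
  restrict : ∀ {k m} → (Mat k m → Set) → (Vecᶠ k → Set) → Mat k m → Set
  restrict S U M = S M × (∀ v → ColSpace M v → U v)

  translate : ∀ {k m} → (Mat k m → Set) → Mat k m → Mat k m → Set
  translate C X N = Σ _ (λ M → C M × N ≡ M +ₘ X)

  HasSize : ∀ {k m} → (Mat k m → Set) → ℕ → Set
  HasSize {k} {m} S n = Σ (List (Mat k m)) λ xs →
    Unique xs × length xs ≡ n × (∀ M → (S M → M ∈ xs) × (M ∈ xs → S M))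

  -- q ≠ 0 (the field has at least the element 0#)
  qNonZero : NonZero q
  qNonZero = aux q enum
    where
    aux : (n : ℕ) → Fin n ↔ Carrier → NonZero n
    aux ℕ.zero e with Inverse.from e 0#
    ... | ()
    aux (ℕ.suc _) _ = _

  -- |C| / q^{m(k-u)}  (natural-number division)
  divPow : ℕ → ℕ → ℕ
  divPow n e = _/_ n (q ^ e) {{ℕP.m^n≢0 q e {{qNonZero}}}}

module Submission where

-- Write W for the additive group of matrices
-- whose column space lies in U, so that S(U) = S ∩ W for every S; W contains
-- q^(um) distinct matrices.  For any X, (C + X)(U) = (C + X) ∩ W.
--
-- The argument is pure abelian-group counting (module CosetCounting):
--  * if a coset A + t meets a subgroup B, then (A + t) ∩ B is a translate of
--    A ∩ B, so both have the same size (translate-size);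
--  * |A| · |B| ≤ |A + B| · |A ∩ B| (product-bound), so the hypothesis
--    |A ∩ B| · |G| ≤ |A| · |B| forces A + B = G, i.e. every coset A + t
--    meets B (coset-meets); together these give coset-size.

open import Defs
open import Level using (0ℓ)
open import Algebra.Core using (Op₁; Op₂)
open import Algebra.Bundles using (AbelianGroup; CommutativeRing)
open import Algebra.Structures using (IsAbelianGroup)
open import Data.Nat as ℕ using (ℕ; _≤_; _<_; _*_; _^_; _∸_; z≤n; s≤s; >-nonZero)
open import Data.Nat.Properties
  using (<-irrefl; *-monoˡ-<; ^-*-assoc; ^-distribˡ-+-*; ^-monoʳ-≤; *-monoʳ-≤; *-monoˡ-≤;
         *-assoc; *-comm; +-comm; *-distribˡ-+; m≤n+m∸n; m^n≢0; module ≤-Reasoning)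
open import Data.Nat.DivMod using (m/n*n≤m)
open import Data.Fin as Fin using ()
open import Data.Product using (Σ; _×_; _,_; proj₁; proj₂)
open import Data.Empty using (⊥-elim)
open import Data.List as List using (List; []; _∷_; length; cartesianProductWith; cartesianProduct; filter)
open import Data.List.Properties using (length-++; length-map; length-removeAt′; length-tabulate; filter-notAll)
open import Data.List.Relation.Unary.All as ListAll using ()
import Data.List.Relation.Unary.AllPairs as AllPairs
open import Data.List.Relation.Unary.Any as Any using (Any; here; there; _─_)
open import Data.List.Membership.Propositional using (_∈_; find; lose)
open import Data.List.Membership.Propositional.Properties
  using (∈-map⁺; ∈-map⁻; ∈-filter⁺; ∈-tabulate⁺; ∈-cartesianProductWith⁺; ∈-cartesianProduct⁺;
         ∈-cartesianProduct⁻)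
open import Data.List.Relation.Binary.Subset.Propositional using (_⊆_)
open import Data.List.Relation.Unary.Unique.Propositional using (Unique)
open import Data.List.Relation.Unary.Unique.Propositional.Properties
  using (map⁺; tabulate⁺; cartesianProductWith⁺; cartesianProduct⁺)
open import Data.Vec as Vec using (Vec; []; _∷_; zipWith; replicate)
open import Data.Vec.Properties
  using (zipWith-assoc; zipWith-identityˡ; zipWith-identityʳ; zipWith-inverseˡ; zipWith-inverseʳ;
         zipWith-comm; map-cong; map-replicate; ≡-dec; ∷-injective; ∷-injectiveˡ; ∷-injectiveʳ)
open import Data.Vec.Relation.Unary.All as VecAll using ()
import Data.Vec.Relation.Unary.All.Properties as VecAll
open import Function.Bundles using (Inverse; Injection)
open import Function.Properties.Inverse using (↔⇒↣; ↔-sym)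
open import Relation.Nullary using (¬_; Dec; yes; no; ¬?)
open import Relation.Nullary.Decidable using (via-injection)
open import Relation.Unary using (Pred; _∩_)
open import Relation.Binary.Definitions using (DecidableEquality)
open import Relation.Binary.PropositionalEquality as ≡

∈-─ : ∀ {A : Set} {x y : A} {ys} (x∈ys : x ∈ ys) → y ∈ ys → ¬ y ≡ x → y ∈ (ys ─ x∈ys)
∈-─ (here refl) (here refl) y≢x = ⊥-elim (y≢x refl)
∈-─ (here refl) (there y∈ys) _ = y∈ys
∈-─ (there x∈ys) (here refl) _ = here refl
∈-─ (there x∈ys) (there y∈ys) y≢x = there (∈-─ x∈ys y∈ys y≢x)

unique-⊆⇒length-≤ : ∀ {A : Set} {xs ys : List A} → Unique xs → xs ⊆ ys → length xs ≤ length ys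
unique-⊆⇒length-≤ {xs = []} _ _ = z≤n
unique-⊆⇒length-≤ {xs = x ∷ xs} {ys} (x∉xs AllPairs.∷ xs-unique) sub =
  subst (length (x ∷ xs) ≤_) (sym (length-removeAt′ ys (Any.index x∈ys)))
    (s≤s (unique-⊆⇒length-≤ xs-unique λ {y} y∈xs →
      ∈-─ x∈ys (sub (there y∈xs)) (λ y≡x → ListAll.lookup x∉xs y∈xs (sym y≡x))))
  where
  x∈ys : x ∈ ys
  x∈ys = sub (here refl)

length-cartesianProductWith : ∀ {A B C : Set} (f : A → B → C) xs ys →
  length (cartesianProductWith f xs ys) ≡ length xs * length ys
length-cartesianProductWith f [] ys = refl
length-cartesianProductWith f (x ∷ xs) ys =
  trans (length-++ (List.map (f x) ys))
        (cong₂ ℕ._+_ (length-map (f x) ys) (length-cartesianProductWith f xs ys))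

allVectors : ∀ {A : Set} → List A → (n : ℕ) → List (Vec A n)
allVectors xs ℕ.zero    = Vec.[] ∷ []
allVectors xs (ℕ.suc n) = cartesianProductWith Vec._∷_ xs (allVectors xs n)

allVectors-complete : ∀ {A : Set} {xs : List A} → (∀ x → x ∈ xs) → ∀ {n} (v : Vec A n) → v ∈ allVectors xs n
allVectors-complete xs-complete Vec.[]       = here refl
allVectors-complete xs-complete (x Vec.∷ v) =
  ∈-cartesianProductWith⁺ Vec._∷_ (xs-complete x) (allVectors-complete xs-complete v)

allVectors-unique : ∀ {A : Set} {xs : List A} → Unique xs → ∀ n → Unique (allVectors xs n)
allVectors-unique xs-unique ℕ.zero    = ListAll.[] AllPairs.∷ AllPairs.[]
allVectors-unique xs-unique (ℕ.suc n) =
  cartesianProductWith⁺ Vec._∷_ ∷-injective xs-unique (allVectors-unique xs-unique n)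

allVectors-length : ∀ {A : Set} (xs : List A) n → length (allVectors xs n) ≡ length xs ^ n
allVectors-length xs ℕ.zero    = refl
allVectors-length xs (ℕ.suc n) =
  trans (length-cartesianProductWith Vec._∷_ xs (allVectors xs n))
        (cong (length xs *_) (allVectors-length xs n))

module DifferenceLaws {G : Set} {add : Op₂ G} {unit : G} {neg : Op₁ G}
  (isAbelianGroup : IsAbelianGroup _≡_ add unit neg) where

  abelianGroup : AbelianGroup 0ℓ 0ℓ
  abelianGroup = record { isAbelianGroup = isAbelianGroup }

  open AbelianGroup abelianGroup public
    using (_∙_; ε; _⁻¹; _-_; assoc; comm; identityʳ; inverseˡ; inverseʳ)
  open import Algebra.Properties.AbelianGroup abelianGroup public
    using (∙-cancelˡ; ∙-cancelʳ; ⁻¹-∙-comm; inverseʳ-unique; x∙y⁻¹≈ε⇒x≈y; x≈y⇒x∙y⁻¹≈ε; //-rightDividesˡ)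
  open import Algebra.Properties.CommutativeSemigroup (AbelianGroup.commutativeSemigroup abelianGroup)
    using (interchange)
  open ≡-Reasoning

  -‿interchange : ∀ p q r s → (p ∙ r) - (q ∙ s) ≡ (p - q) ∙ (r - s)
  -‿interchange p q r s = begin
    (p ∙ r) ∙ (q ∙ s) ⁻¹      ≡⟨ cong ((p ∙ r) ∙_) (⁻¹-∙-comm q s) ⟨
    (p ∙ r) ∙ (q ⁻¹ ∙ s ⁻¹)   ≡⟨ interchange p r (q ⁻¹) (s ⁻¹) ⟩
    (p - q) ∙ (r - s)         ∎

  -‿translate : ∀ x y z → (x ∙ z) - (y ∙ z) ≡ x - y
  -‿translate x y z = begin
    (x ∙ z) - (y ∙ z)    ≡⟨ -‿interchange x y z z ⟩
    (x - y) ∙ (z - z)    ≡⟨ cong ((x - y) ∙_) (inverseʳ z) ⟩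
    (x - y) ∙ ε          ≡⟨ identityʳ (x - y) ⟩
    x - y                ∎

  -‿swap : ∀ {a b a′ b′} → a ∙ b ≡ a′ ∙ b′ → a - a′ ≡ b′ - b
  -‿swap {a} {b} {a′} {b′} eq = begin
    a - a′                ≡⟨ -‿translate a a′ b ⟨
    (a ∙ b) - (a′ ∙ b)    ≡⟨ cong₂ _-_ eq (comm a′ b) ⟩
    (a′ ∙ b′) - (b ∙ a′)  ≡⟨ cong (_- (b ∙ a′)) (comm a′ b′) ⟩
    (b′ ∙ a′) - (b ∙ a′)  ≡⟨ -‿translate b′ b a′ ⟩
    b′ - b                ∎

  ∙-move-inverse : ∀ {a b t} → a ∙ b ≡ t ⁻¹ → a ∙ t ≡ b ⁻¹
  ∙-move-inverse {a} {b} {t} eq = inverseʳ-unique b (a ∙ t) (begin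
    b ∙ (a ∙ t)   ≡⟨ assoc b a t ⟨
    (b ∙ a) ∙ t   ≡⟨ cong (_∙ t) (trans (comm b a) eq) ⟩
    t ⁻¹ ∙ t      ≡⟨ inverseˡ t ⟩
    ε             ∎)

module CosetCounting {G : Set} {add : Op₂ G} {unit : G} {neg : Op₁ G}
  (isAbelianGroup : IsAbelianGroup _≡_ add unit neg)
  (_≟_ : DecidableEquality G) where

  open DifferenceLaws isAbelianGroup

  Size : Pred G 0ℓ → ℕ → Set
  Size P n = Σ (List G) λ xs →
    Unique xs × length xs ≡ n × (∀ x → (P x → x ∈ xs) × (x ∈ xs → P x))

  record IsSubgroup (A : Pred G 0ℓ) : Set where
    field
      ε∈  : A ε
      ∙∈  : ∀ {x y} → A x → A y → A (x ∙ y)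
      ⁻¹∈ : ∀ {x} → A x → A (x ⁻¹)

    -∈ : ∀ {x y} → A x → A y → A (x - y)
    -∈ ax ay = ∙∈ ax (⁻¹∈ ay)

  open IsSubgroup

  Translate : Pred G 0ℓ → G → Pred G 0ℓ
  Translate A t y = Σ G λ x → A x × y ≡ x ∙ t

  -- If the coset A + t meets B in some point s₀, then (A + t) ∩ B is the
  -- translate of A ∩ B by s₀, hence has the same size.
  translate-size : ∀ {A B x₀ t n} → IsSubgroup A → IsSubgroup B →
    A x₀ → B (x₀ ∙ t) → Size (A ∩ B) n → Size (Translate A t ∩ B) n
  translate-size {A} {B} {x₀} {t} sA sB x₀∈A s₀∈B (ds , ds-unique , ds-length , ds-enum) =
    List.map (_∙ s₀) ds , map⁺ (∙-cancelʳ s₀ _ _) ds-unique ,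
    trans (length-map (_∙ s₀) ds) ds-length , λ y → into y , out y
    where
    s₀ : G
    s₀ = x₀ ∙ t

    -- y = (y - s₀) ∙ s₀ with y - s₀ = x - x₀ ∈ A ∩ B
    into : ∀ y → (Translate A t ∩ B) y → y ∈ List.map (_∙ s₀) ds
    into y ((x , x∈A , refl) , y∈B) =
      subst (_∈ List.map (_∙ s₀) ds) (//-rightDividesˡ s₀ y)
        (∈-map⁺ (_∙ s₀) (proj₁ (ds-enum (y - s₀)) (y-s₀∈A , -∈ sB y∈B s₀∈B)))
      where
      y-s₀∈A : A (y - s₀)
      y-s₀∈A = subst A (sym (-‿translate x x₀ t)) (-∈ sA x∈A x₀∈A)

    -- d ∙ s₀ = (d ∙ x₀) ∙ t with d ∙ x₀ ∈ A
    out : ∀ y → y ∈ List.map (_∙ s₀) ds → (Translate A t ∩ B) y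
    out y y∈ with ∈-map⁻ (_∙ s₀) y∈
    ... | d , d∈ds , refl with proj₂ (ds-enum d) d∈ds
    ...   | d∈A , d∈B = (d ∙ x₀ , ∙∈ sA d∈A x₀∈A , sym (assoc d x₀ t)) , ∙∈ sB d∈B s₀∈B

  -- The map (a , b) ↦ (a ∙ b , a - a′),
  -- where a′ ∙ b′ is a fixed decomposition of a ∙ b, is injective.
  module Decompositions {A B : Pred G 0ℓ} (sA : IsSubgroup A) (sB : IsSubgroup B)
    (as bs : List G) (as⊆A : ∀ {a} → a ∈ as → A a) (bs⊆B : ∀ {b} → b ∈ bs → B b) where

    Decomposes : G → Set
    Decomposes s = Any (λ p → proj₁ p ∙ proj₂ p ≡ s) (cartesianProduct as bs)

    decomposes? : ∀ s → Dec (Decomposes s)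
    decomposes? s = Any.any? (λ p → (proj₁ p ∙ proj₂ p) ≟ s) (cartesianProduct as bs)

    anchor : G → G
    anchor s with decomposes? s
    ... | yes dec = proj₁ (proj₁ (find dec))
    ... | no _    = ε

    anchor-spec : ∀ {a b} → a ∈ as → b ∈ bs →
      Σ G λ b′ → A (anchor (a ∙ b)) × B b′ × anchor (a ∙ b) ∙ b′ ≡ a ∙ b
    anchor-spec {a} {b} a∈ b∈ with decomposes? (a ∙ b)
    ... | yes dec with find dec
    ...   | (a′ , b′) , p∈ , eq with ∈-cartesianProduct⁻ as bs p∈
    ...     | a′∈ , b′∈ = b′ , as⊆A a′∈ , bs⊆B b′∈ , eq
    anchor-spec {a} {b} a∈ b∈ | no none =
      ⊥-elim (none (lose (∈-cartesianProduct⁺ a∈ b∈) refl))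

    difference : G × G → G × G
    difference (a , b) = a ∙ b , a - anchor (a ∙ b)

    difference-injective : ∀ {p p′} → difference p ≡ difference p′ → p ≡ p′
    difference-injective {a , b} {a′ , b′} eq = cong₂ _,_ a≡a′ b≡b′
      where
      sum≡ : a ∙ b ≡ a′ ∙ b′
      sum≡ = cong proj₁ eq
      a≡a′ : a ≡ a′
      a≡a′ = ∙-cancelʳ _ a a′
        (trans (cong proj₂ eq) (cong (λ s → a′ - anchor s) (sym sum≡)))
      b≡b′ : b ≡ b′
      b≡b′ = ∙-cancelˡ a b b′ (trans sum≡ (cong (_∙ b′) (sym a≡a′)))

    product-bound : ∀ {ds ts} → Unique as → Unique bs →
      (∀ x → (A ∩ B) x → x ∈ ds) →
      (∀ {a b} → a ∈ as → b ∈ bs → a ∙ b ∈ ts) →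
      length as * length bs ≤ length ts * length ds
    product-bound {ds} {ts} as-unique bs-unique ds-complete sums∈ts =
      subst₂ _≤_
        (trans (length-map difference (cartesianProduct as bs))
               (length-cartesianProductWith _,_ as bs))
        (length-cartesianProductWith _,_ ts ds)
        (unique-⊆⇒length-≤ (map⁺ difference-injective (cartesianProduct⁺ as-unique bs-unique))
                           image⊆)
      where
      image⊆ : List.map difference (cartesianProduct as bs) ⊆ cartesianProduct ts ds
      image⊆ p∈ with ∈-map⁻ difference p∈
      ... | (a , b) , ab∈ , refl with ∈-cartesianProduct⁻ as bs ab∈
      ...   | a∈ , b∈ with anchor-spec a∈ b∈
      ...     | b′ , a′∈A , b′∈B , eq =
        ∈-cartesianProduct⁺ (sums∈ts a∈ b∈)
          (ds-complete _ ( -∈ sA (as⊆A a∈) a′∈A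
                         , subst B (sym (-‿swap (sym eq))) (-∈ sB b′∈B (bs⊆B b∈))))

    -- If |A ∩ B| · |G| ≤ |A| · |B| then A + B = G: otherwise all sums avoid
    -- some t⁻¹ and product-bound gives |A| · |B| ≤ (|G| - 1) · |A ∩ B|.
    -- Hence every coset A + t meets B.
    coset-meets : ∀ {ds} → Unique as → Unique bs → (∀ x → (A ∩ B) x → x ∈ ds) →
      (univ : List G) → (∀ x → x ∈ univ) →
      length ds * length univ ≤ length as * length bs →
      ∀ t → Σ G λ a → A a × B (a ∙ t)
    coset-meets {ds} as-unique bs-unique ds-complete univ univ-complete bound t
      with decomposes? (t ⁻¹)
    ... | yes dec with find dec
    ...   | (a , b) , p∈ , a∙b≡t⁻¹ with ∈-cartesianProduct⁻ as bs p∈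
    ...     | a∈ , b∈ = a , as⊆A a∈ , subst B (sym (∙-move-inverse a∙b≡t⁻¹)) (⁻¹∈ sB (bs⊆B b∈))
    coset-meets {ds} as-unique bs-unique ds-complete univ univ-complete bound t
      | no t⁻¹∉A+B = ⊥-elim (<-irrefl refl (begin-strict
        length ds * length univ   ≤⟨ bound ⟩
        length as * length bs     ≤⟨ product-bound as-unique bs-unique ds-complete sum∈ts ⟩
        length ts * length ds     <⟨ *-monoˡ-< (length ds) {{>-nonZero ds-nonempty}} ts-shorter ⟩
        length univ * length ds   ≡⟨ *-comm (length univ) (length ds) ⟩
        length ds * length univ   ∎))
      where
      open ≤-Reasoning
      avoids-t⁻¹ : ∀ s → Dec (¬ s ≡ t ⁻¹)
      avoids-t⁻¹ s = ¬? (s ≟ (t ⁻¹))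
      ts : List G
      ts = filter avoids-t⁻¹ univ
      sum∈ts : ∀ {a b} → a ∈ as → b ∈ bs → a ∙ b ∈ ts
      sum∈ts a∈ b∈ = ∈-filter⁺ avoids-t⁻¹ (univ-complete _)
        (λ eq → t⁻¹∉A+B (lose (∈-cartesianProduct⁺ a∈ b∈) eq))
      ts-shorter : length ts < length univ
      ts-shorter = filter-notAll avoids-t⁻¹ univ (lose (univ-complete (t ⁻¹)) (λ ne → ne refl))
      ds-nonempty : 0 < length ds
      ds-nonempty with ds-complete ε (ε∈ sA , ε∈ sB)
      ... | here _  = s≤s z≤n
      ... | there _ = s≤s z≤n

  coset-size : ∀ {A B nA nAB} → IsSubgroup A → IsSubgroup B →
    (univ : List G) → (∀ x → x ∈ univ) →
    (bs : List G) → Unique bs → (∀ {b} → b ∈ bs → B b) →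
    Size A nA → Size (A ∩ B) nAB → nAB * length univ ≤ nA * length bs →
    ∀ t → Size (Translate A t ∩ B) nAB
  coset-size sA sB univ univ-complete bs bs-unique bs⊆B
    (as , as-unique , refl , as-enum) sizeAB@(ds , _ , refl , ds-enum) bound t
    with Decompositions.coset-meets sA sB as bs (λ {a} → proj₂ (as-enum a)) bs⊆B
           as-unique bs-unique (λ x → proj₁ (ds-enum x)) univ univ-complete bound t
  ... | a , a∈A , a∙t∈B = translate-size sA sB a∈A a∙t∈B sizeAB

zipWith-isAbelianGroup : ∀ {A : Set} {_∙_ : A → A → A} {ε : A} {_⁻¹ : A → A} →
  IsAbelianGroup _≡_ _∙_ ε _⁻¹ → ∀ n →
  IsAbelianGroup _≡_ (zipWith {n = n} _∙_) (replicate n ε) (Vec.map _⁻¹)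
zipWith-isAbelianGroup G n = record
  { isGroup = record
    { isMonoid = record
      { isSemigroup = record
        { isMagma = record { isEquivalence = ≡.isEquivalence ; ∙-cong = cong₂ _ }
        ; assoc = zipWith-assoc assoc }
      ; identity = zipWith-identityˡ identityˡ , zipWith-identityʳ identityʳ }
    ; inverse = zipWith-inverseˡ inverseˡ , zipWith-inverseʳ inverseʳ
    ; ⁻¹-cong = cong _ }
  ; comm = zipWith-comm comm }
  where open IsAbelianGroup G

zipWith-∷-injective : ∀ {A : Set} {n m} {a a′ : Vec A n} {R R′ : Vec (Vec A m) n} →
  zipWith Vec._∷_ a R ≡ zipWith Vec._∷_ a′ R′ → a ≡ a′ × R ≡ R′
zipWith-∷-injective {a = []} {[]} {[]} {[]} _ = refl , refl
zipWith-∷-injective {a = x ∷ a} {x′ ∷ a′} {r ∷ R} {r′ ∷ R′} eq =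
  cong₂ _∷_ (∷-injectiveˡ (∷-injectiveˡ eq)) (proj₁ tails≡) ,
  cong₂ _∷_ (∷-injectiveʳ (∷-injectiveˡ eq)) (proj₂ tails≡)
  where
  tails≡ : a ≡ a′ × R ≡ R′
  tails≡ = zipWith-∷-injective (∷-injectiveʳ eq)

map-injective : ∀ {A B : Set} {f : A → B} → (∀ {x y} → f x ≡ f y → x ≡ y) →
  ∀ {n} {xs ys : Vec A n} → Vec.map f xs ≡ Vec.map f ys → xs ≡ ys
map-injective f-inj {xs = []} {[]} _ = refl
map-injective f-inj {xs = x ∷ xs} {y ∷ ys} eq =
  cong₂ _∷_ (f-inj (∷-injectiveˡ eq)) (map-injective f-inj (∷-injectiveʳ eq))

module FieldMatrices (F : FiniteField) where
  open FiniteField F using (Carrier; q; enum; isCommutativeRing)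

  fieldRing : CommutativeRing 0ℓ 0ℓ
  fieldRing = record { isCommutativeRing = isCommutativeRing }

  open CommutativeRing fieldRing
    using (+-isAbelianGroup; _+_; -_; _-_; 0#; 1#; +-identityˡ; distribˡ; distribʳ;
           zeroˡ; zeroʳ; +-commutativeSemigroup; ring)
    renaming (_*_ to _·_; *-assoc to ·-assoc; *-comm to ·-comm)
  open import Algebra.Properties.Ring ring using (-1*x≈-x; [y-z]x≈yx-zx)
  open import Algebra.Properties.CommutativeSemigroup +-commutativeSemigroup using (interchange)
  open ≡-Reasoning

  infixl 6 _+v_ _+m_ _-v_
  infixr 7 _·v_ _·m_
  infix  8 _⊛v_

  _+v_ : ∀ {n} → Vecᶠ F n → Vecᶠ F n → Vecᶠ F n
  _+v_ = _+ᵥ_ F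

  _·v_ : ∀ {n} → Carrier → Vecᶠ F n → Vecᶠ F n
  _·v_ = _·ᵥ_ F

  _+m_ : ∀ {k m} → Mat F k m → Mat F k m → Mat F k m
  _+m_ = _+ₘ_ F

  _·m_ : ∀ {k m} → Carrier → Mat F k m → Mat F k m
  _·m_ = _·ₘ_ F

  _⊛v_ : ∀ {k m} → Mat F k m → Vecᶠ F m → Vecᶠ F k
  _⊛v_ = _⊛_ F

  negᵥ : ∀ {n} → Vecᶠ F n → Vecᶠ F n
  negᵥ = Vec.map (-_)

  negₘ : ∀ {k m} → Mat F k m → Mat F k m
  negₘ = Vec.map negᵥ

  vec-isAbelianGroup : ∀ n → IsAbelianGroup _≡_ (_+v_ {n}) (zeroV F) negᵥ
  vec-isAbelianGroup = zipWith-isAbelianGroup +-isAbelianGroup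

  mat-isAbelianGroup : ∀ k m → IsAbelianGroup _≡_ (_+m_ {k} {m}) (zeroM F) negₘ
  mat-isAbelianGroup k m = zipWith-isAbelianGroup (vec-isAbelianGroup m) k

  module VecLaws {n : ℕ} = DifferenceLaws (vec-isAbelianGroup n)

  _-v_ : ∀ {n} → Vecᶠ F n → Vecᶠ F n → Vecᶠ F n
  _-v_ = VecLaws._-_

  -- equality in F is decidable, being equality of the indices in Fin q
  _≟_ : DecidableEquality Carrier
  _≟_ = via-injection (↔⇒↣ (↔-sym enum)) Fin._≟_

  _≟ₘ_ : ∀ {k m} → DecidableEquality (Mat F k m)
  _≟ₘ_ = ≡-dec (≡-dec _≟_)

  elements : List Carrier
  elements = List.tabulate (Inverse.to enum)

  elements-complete : ∀ x → x ∈ elements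
  elements-complete x =
    subst (_∈ elements) (Inverse.strictlyInverseˡ enum x) (∈-tabulate⁺ (Inverse.from enum x))

  elements-unique : Unique elements
  elements-unique = tabulate⁺ (Injection.injective (↔⇒↣ enum))

  elements-length : length elements ≡ q
  elements-length = length-tabulate (Inverse.to enum)

  dot : ∀ {n} → Vecᶠ F n → Vecᶠ F n → Carrier
  dot r c = Vec.foldr _ _+_ 0# (zipWith _·_ r c)

  dot-+ : ∀ {n} (r s c : Vecᶠ F n) → dot (r +v s) c ≡ dot r c + dot s c
  dot-+ [] [] [] = sym (+-identityˡ 0#)
  dot-+ (r ∷ rs) (s ∷ ss) (c ∷ cs) = begin
    (r + s) · c + dot (rs +v ss) cs            ≡⟨ cong₂ _+_ (distribʳ c r s) (dot-+ rs ss cs) ⟩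
    (r · c + s · c) + (dot rs cs + dot ss cs)  ≡⟨ interchange (r · c) (s · c) (dot rs cs) (dot ss cs) ⟩
    (r · c + dot rs cs) + (s · c + dot ss cs)  ∎

  dot-· : ∀ {n} a (r c : Vecᶠ F n) → dot (a ·v r) c ≡ a · dot r c
  dot-· a [] [] = sym (zeroʳ a)
  dot-· a (r ∷ rs) (c ∷ cs) = begin
    a · r · c + dot (a ·v rs) cs  ≡⟨ cong₂ _+_ (·-assoc a r c) (dot-· a rs cs) ⟩
    a · (r · c) + a · dot rs cs   ≡⟨ distribˡ a (r · c) (dot rs cs) ⟨
    a · (r · c + dot rs cs)       ∎

  dot-0 : ∀ {n} (c : Vecᶠ F n) → dot (zeroV F) c ≡ 0#
  dot-0 [] = refl
  dot-0 (c ∷ cs) = trans (cong₂ _+_ (zeroˡ c) (dot-0 cs)) (+-identityˡ 0#)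

  ⊛-+ : ∀ {k m} (M N : Mat F k m) c → (M +m N) ⊛v c ≡ M ⊛v c +v N ⊛v c
  ⊛-+ [] [] c = refl
  ⊛-+ (r ∷ M) (s ∷ N) c = cong₂ _∷_ (dot-+ r s c) (⊛-+ M N c)

  ⊛-· : ∀ {k m} a (M : Mat F k m) c → (a ·m M) ⊛v c ≡ a ·v M ⊛v c
  ⊛-· a [] c = refl
  ⊛-· a (r ∷ M) c = cong₂ _∷_ (dot-· a r c) (⊛-· a M c)

  ⊛-0 : ∀ {k m} (c : Vecᶠ F m) → zeroM F {k} ⊛v c ≡ zeroV F
  ⊛-0 {ℕ.zero} c = refl
  ⊛-0 {ℕ.suc k} c = cong₂ _∷_ (dot-0 c) (⊛-0 {k} c)

  -- scaling by -1 is negation, so linear subspaces are additive subgroups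
  -1·m≡negₘ : ∀ {k m} (M : Mat F k m) → (- 1#) ·m M ≡ negₘ M
  -1·m≡negₘ = map-cong (map-cong -1*x≈-x)

  ·v-distrib-- : ∀ {n} x y (v : Vecᶠ F n) → (x - y) ·v v ≡ x ·v v -v y ·v v
  ·v-distrib-- x y [] = refl
  ·v-distrib-- x y (w ∷ v) = cong₂ _∷_ ([y-z]x≈yx-zx w x y) (·v-distrib-- x y v)

  lincomb-- : ∀ {k u} (a a′ : Vecᶠ F u) (b : Vec (Vecᶠ F k) u) →
    lincomb F (a -v a′) b ≡ lincomb F a b -v lincomb F a′ b
  lincomb-- [] [] [] = sym (VecLaws.inverseʳ (zeroV F))
  lincomb-- (x ∷ a) (y ∷ a′) (v ∷ b) = begin
    (x - y) ·v v +v lincomb F (a -v a′) b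
      ≡⟨ cong₂ _+v_ (·v-distrib-- x y v) (lincomb-- a a′ b) ⟩
    (x ·v v -v y ·v v) +v (lincomb F a b -v lincomb F a′ b)
      ≡⟨ VecLaws.-‿interchange (x ·v v) (y ·v v) (lincomb F a b) (lincomb F a′ b) ⟨
    (x ·v v +v lincomb F a b) -v (y ·v v +v lincomb F a′ b) ∎

  lincomb-injective : ∀ {k u} {b : Vec (Vecᶠ F k) u} →
    (∀ c → lincomb F c b ≡ zeroV F → c ≡ zeroV F) →
    ∀ {a a′} → lincomb F a b ≡ lincomb F a′ b → a ≡ a′
  lincomb-injective {b = b} independent {a} {a′} eq =
    VecLaws.x∙y⁻¹≈ε⇒x≈y a a′ (independent (a -v a′)
      (trans (lincomb-- a a′ b) (VecLaws.x≈y⇒x∙y⁻¹≈ε eq)))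

  lincomb-∈ : ∀ {k u} {U : Vecᶠ F k → Set} → IsSubspace F U →
    (c : Vecᶠ F u) {vs : Vec (Vecᶠ F k) u} → VecAll.All U vs → U (lincomb F c vs)
  lincomb-∈ sU [] VecAll.[] = IsSubspace.zero∈ sU
  lincomb-∈ sU (c ∷ cs) (uv VecAll.∷ uvs) = IsSubspace.+∈ sU (IsSubspace.·∈ sU c uv) (lincomb-∈ sU cs uvs)

  fromColumns : ∀ {k m} → Vec (Vecᶠ F k) m → Mat F k m
  fromColumns {k} [] = replicate k []
  fromColumns (col ∷ cols) = zipWith Vec._∷_ col (fromColumns cols)

  fromColumns-injective : ∀ {k m} {cols cols′ : Vec (Vecᶠ F k) m} →
    fromColumns cols ≡ fromColumns cols′ → cols ≡ cols′
  fromColumns-injective {cols = []} {[]} _ = refl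
  fromColumns-injective {cols = col ∷ cols} {col′ ∷ cols′} eq with zipWith-∷-injective eq
  ... | refl , rest≡ = cong (col ∷_) (fromColumns-injective rest≡)

  fromColumns-⊛ : ∀ {k m} (cols : Vec (Vecᶠ F k) m) c → fromColumns cols ⊛v c ≡ lincomb F c cols
  fromColumns-⊛ {k} [] [] = map-replicate (λ row → dot row []) [] k
  fromColumns-⊛ (col ∷ cols) (c ∷ cs) =
    trans (prepend-column col (fromColumns cols)) (cong (c ·v col +v_) (fromColumns-⊛ cols cs))
    where
    prepend-column : ∀ {k} (col : Vecᶠ F k) R → zipWith Vec._∷_ col R ⊛v (c ∷ cs) ≡ c ·v col +v R ⊛v cs
    prepend-column [] [] = refl
    prepend-column (x ∷ col) (r ∷ R) = cong₂ _∷_ (cong (_+ dot r cs) (·-comm x c)) (prepend-column col R)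

  allMatrices : ∀ k m → List (Mat F k m)
  allMatrices k m = allVectors (allVectors elements m) k

  allMatrices-complete : ∀ {k m} (M : Mat F k m) → M ∈ allMatrices k m
  allMatrices-complete = allVectors-complete (allVectors-complete elements-complete)

  allMatrices-length : ∀ k m → length (allMatrices k m) ≡ (q ^ m) ^ k
  allMatrices-length k m = begin
    length (allVectors (allVectors elements m) k)  ≡⟨ allVectors-length (allVectors elements m) k ⟩
    length (allVectors elements m) ^ k             ≡⟨ cong (_^ k) (allVectors-length elements m) ⟩
    (length elements ^ m) ^ k                      ≡⟨ cong (λ n → (n ^ m) ^ k) elements-length ⟩
    (q ^ m) ^ k                                    ∎

  module Matrices (k m : ℕ) where
    open CosetCounting (mat-isAbelianGroup k m) _≟ₘ_ public

    linear⇒subgroup : {P : Mat F k m → Set} → P (zeroM F) →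
      (∀ {M N} → P M → P N → P (M +m N)) → (∀ a {M} → P M → P (a ·m M)) → IsSubgroup P
    linear⇒subgroup {P} zero∈ +∈ ·∈ = record
      { ε∈ = zero∈ ; ∙∈ = +∈ ; ⁻¹∈ = λ {M} pM → subst P (-1·m≡negₘ M) (·∈ (- 1#) pM) }

    code⇒subgroup : {C : Mat F k m → Set} → IsLinearCode F C → IsSubgroup C
    code⇒subgroup isCode = linear⇒subgroup zero∈ +∈ ·∈
      where open IsLinearCode isCode

    -- the matrices whose column space is contained in U, so that
    -- restrict F S U = S ∩ Within U
    Within : (Vecᶠ F k → Set) → Mat F k m → Set
    Within U M = ∀ v → ColSpace F M v → U v

    within-intro : ∀ {U M} → (∀ c → U (M ⊛v c)) → Within U M
    within-intro U∋M⊛ v (c , refl) = U∋M⊛ c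

    within-subgroup : ∀ {U} → IsSubspace F U → IsSubgroup (Within U)
    within-subgroup {U} sU = linear⇒subgroup
      (within-intro λ c → subst U (sym (⊛-0 c)) zero∈)
      (λ {M} {N} wM wN → within-intro λ c →
        subst U (sym (⊛-+ M N c)) (+∈ (wM _ (c , refl)) (wN _ (c , refl))))
      (λ a {M} wM → within-intro λ c → subst U (sym (⊛-· a M c)) (·∈ a (wM _ (c , refl))))
      where open IsSubspace sU

    -- For a basis b of U with u vectors, the (q^u)^m matrices whose columns are
    -- combinations of b: distinct (b is independent) and within U (b spans U).
    module SpannedMatrices {U : Vecᶠ F k → Set} {u : ℕ} (sU : IsSubspace F U) (dim : HasDim F U u) where
      b : Vec (Vecᶠ F k) u
      b = proj₁ dim

      combine : Vec (Vecᶠ F u) m → Mat F k m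
      combine A = fromColumns (Vec.map (λ a → lincomb F a b) A)

      spanned : List (Mat F k m)
      spanned = List.map combine (allVectors (allVectors elements u) m)

      spanned-length : length spanned ≡ (q ^ u) ^ m
      spanned-length = begin
        length spanned                                 ≡⟨ length-map combine (allVectors (allVectors elements u) m) ⟩
        length (allVectors (allVectors elements u) m)  ≡⟨ allVectors-length (allVectors elements u) m ⟩
        length (allVectors elements u) ^ m             ≡⟨ cong (_^ m) (allVectors-length elements u) ⟩
        (length elements ^ u) ^ m                      ≡⟨ cong (λ n → (n ^ u) ^ m) elements-length ⟩
        (q ^ u) ^ m                                    ∎

      spanned-unique : Unique spanned
      spanned-unique = map⁺ (λ eq → map-injective (lincomb-injective (proj₁ (proj₂ dim)))
                                                   (fromColumns-injective eq))
                            (allVectors-unique (allVectors-unique elements-unique u) m)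

      spanned-within : ∀ {M} → M ∈ spanned → Within U M
      spanned-within M∈ with ∈-map⁻ combine M∈
      ... | A , _ , refl = within-intro λ c →
        subst U (sym (fromColumns-⊛ _ c))
          (lincomb-∈ sU c (VecAll.map⁺ (VecAll.universal combination∈U A)))
        where
        combination∈U : ∀ a → U (lincomb F a b)
        combination∈U a = proj₂ (proj₂ (proj₂ dim) (lincomb F a b)) (a , refl)

-- Since m·k ≤ m·(k ∸ u) + u·m, the hypothesis n · q^(m(k-u)) ≤ N on the
-- sizes gives n · |F^(k×m)| ≤ N · q^(um).
power-bound : ∀ q k m u {n N} .{{_ : ℕ.NonZero q}} →
  n * q ^ (m * (k ∸ u)) ≤ N → n * (q ^ m) ^ k ≤ N * (q ^ u) ^ m
power-bound q k m u {n} {N} bound = begin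
  n * (q ^ m) ^ k                        ≡⟨ cong (n *_) (^-*-assoc q m k) ⟩
  n * q ^ (m * k)                        ≤⟨ *-monoʳ-≤ n (^-monoʳ-≤ q exponent-bound) ⟩
  n * q ^ (m * (k ∸ u) ℕ.+ u * m)        ≡⟨ cong (n *_) (^-distribˡ-+-* q (m * (k ∸ u)) (u * m)) ⟩
  n * (q ^ (m * (k ∸ u)) * q ^ (u * m))  ≡⟨ *-assoc n _ _ ⟨
  n * q ^ (m * (k ∸ u)) * q ^ (u * m)    ≤⟨ *-monoˡ-≤ (q ^ (u * m)) bound ⟩
  N * q ^ (u * m)                        ≡⟨ cong (N *_) (^-*-assoc q u m) ⟨
  N * (q ^ u) ^ m                        ∎
  where
  open ≤-Reasoning
  exponent-bound : m * k ≤ m * (k ∸ u) ℕ.+ u * m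
  exponent-bound = begin
    m * k                    ≤⟨ *-monoʳ-≤ m (m≤n+m∸n k u) ⟩
    m * (u ℕ.+ (k ∸ u))      ≡⟨ *-distribˡ-+ m u (k ∸ u) ⟩
    m * u ℕ.+ m * (k ∸ u)    ≡⟨ +-comm (m * u) (m * (k ∸ u)) ⟩
    m * (k ∸ u) ℕ.+ m * u    ≡⟨ cong (m * (k ∸ u) ℕ.+_) (*-comm m u) ⟩
    m * (k ∸ u) ℕ.+ u * m    ∎

lemma4p1 : (F : FiniteField) (k m u : ℕ)
    (C : Mat F k m → Set) → IsLinearCode F C →
    (U : Vecᶠ F k → Set) → IsSubspace F U → HasDim F U u →
    (nC nCU : ℕ) → HasSize F C nC → HasSize F (restrict F C U) nCU →
    nCU ≡ divPow F nC (m * (k ∸ u)) →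
    (X : Mat F k m) → HasSize F (restrict F (translate F C X) U) (divPow F nC (m * (k ∸ u)))
lemma4p1 F k m u C isCode U subspace dim nC nCU sizeC sizeCU nCU≡ X =
  coset-size (code⇒subgroup isCode) (within-subgroup subspace)
    (allMatrices k m) allMatrices-complete
    spanned spanned-unique spanned-within
    sizeC (subst (HasSize F (restrict F C U)) nCU≡ sizeCU) size-bound X
  where
  open FiniteField F using (q)
  open FieldMatrices F
  open Matrices k m
  open SpannedMatrices subspace dim
  e : ℕ
  e = m * (k ∸ u)
  -- |C(U)| · |F^(k×m)| ≤ |C| · q^(um), since |C(U)| = ⌊|C| / q^(m(k-u))⌋
  size-bound : divPow F nC e * length (allMatrices k m) ≤ nC * length spanned
  size-bound = subst₂ (λ nG nW → divPow F nC e * nG ≤ nC * nW)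
    (sym (allMatrices-length k m)) (sym spanned-length)
    (power-bound q k m u {divPow F nC e} {{qNonZero F}} (m/n*n≤m nC (q ^ e) {{m^n≢0 q e {{qNonZero F}}}}))
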